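{- Let $p$ be a prime, $k \ge 1$ an integer, $q = p^k$, and $n = q^2 + q + 1$. Let $P^2$ be the projective plane over the finite field $\mathbb{F}_q$: its points are the one-dimensional subspaces of $\mathbb{F}_q^3$ (there are $n$ of them), identified with the $n$ partition indices, and its lines are the sets $S_1, \dots, S_n$, where each line consists of all points $[v]$ with $u \cdot v = 0$ for a fixed nonzero $u \in \mathbb{F}_q^3$ (scalar product over $\mathbb{F}_q$). Let $G = (V, E)$ be a graph with $V \neq \emptyset$ and let $\psi : V \to \{S_1, \dots, S_n\}$ be any map (e.g. $\psi(v) = S_{(v \bmod n)+1}$ when vertices are integers). Suppose each edge $\{u, v\} \in E$ is assigned to a partition index (point) $P(u,v) \in \psi(u) \cap \psi(v)$ (this intersection is a single point when $\psi(u) \ne \psi(v)$, and is the whole line $\psi(u)$ otherwise), and let $E_i$ be the set of edges assigned to point $i$. Then the replication factor $RF = \frac{\sum_{i=1}^{n} |V(E_i)|}{|V|}$, where $V(E_i)$ is the set of vertices incident to an edge of $E_i$, satisfies $$RF \le p^k + 1, \qquad \text{and} \qquad \sqrt{n} \le p^k + 1 \le \sqrt{n} + 1.$$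
   Context: In the projective plane over $\mathbb{F}_q$, any two distinct lines meet in exactly one point and each line contains exactly $q+1$ points. -}

module Defs where

open import Level using (0ℓ)
open import Data.Nat using (ℕ)
open import Data.Fin using (Fin; zero; suc)
open import Data.Fin.Properties using (any?; _≟_)
open import Data.List using (List; length; filter; map)
open import Data.Nat.ListAction using (sum)
open import Data.List.Base using (allFin)
open import Data.Product using (Σ; ∃; _×_; _,_; proj₁; proj₂)
open import Data.Sum using (_⊎_)
open import Data.Sum.Properties using ()
open import Relation.Nullary using (¬_; Dec)
open import Relation.Nullary.Decidable using (_×-dec_; _⊎-dec_)
open import Relation.Binary.PropositionalEquality using (_≡_)
import Relation.Binary.PropositionalEquality as ≡
open import Algebra.Bundles using (CommutativeRing)
open import Function.Bundles using (Bijection)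

IsField : CommutativeRing 0ℓ 0ℓ → Set
IsField R = (¬ (0# ≈ 1#)) × (∀ x → ¬ (x ≈ 0#) → ∃ λ y → x * y ≈ 1#)
  where open CommutativeRing R

record FiniteField (q : ℕ) : Set₁ where
  field
    fieldRing : CommutativeRing 0ℓ 0ℓ
    isField  : IsField fieldRing
    counting : Bijection (CommutativeRing.setoid fieldRing) (≡.setoid (Fin q))
  open CommutativeRing fieldRing public

module _ {q : ℕ} (F : FiniteField q) where
  open FiniteField F using (Carrier; _≈_; _+_; _*_; 0#)

  Vec3 : Set
  Vec3 = Fin 3 → Carrier

  dot : Vec3 → Vec3 → Carrier
  dot u v = (u zero * v zero + u (suc zero) * v (suc zero))
            + u (suc (suc zero)) * v (suc (suc zero))

  IsZeroVec : Vec3 → Set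
  IsZeroVec x = ∀ c → x c ≈ 0#

  _≈Mult_ : Vec3 → Vec3 → Set
  x ≈Mult y = ∃ λ (l : Carrier) → ∀ c → x c ≈ l * y c

  -- An identification of the n points of P^2(F_q) (one-dimensional subspaces
  -- of F_q^3) with the indices Fin n: rep i is a nonzero spanning vector of
  -- the i-th point, and every nonzero vector spans exactly one of these points.
  record PointIndexing (n : ℕ) : Set where
    field
      rep        : Fin n → Vec3
      rep-nonzero : ∀ i → ¬ IsZeroVec (rep i)
      rep-onto   : ∀ x → ¬ IsZeroVec x → ∃ λ i → x ≈Mult rep i
      rep-unique : ∀ x i j → ¬ IsZeroVec x → x ≈Mult rep i → x ≈Mult rep j → i ≡ j

  -- Lines of P^2(F_q): the line S_j consists of the points [v] with u · v = 0,
  -- where u = rep j is a fixed nonzero vector (each nonzero u up to scaling,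
  -- hence each line, occurs for exactly one index j).
  OnLine : {n : ℕ} → PointIndexing n → (j i : Fin n) → Set
  OnLine P j i = dot (PointIndexing.rep P j) (PointIndexing.rep P i) ≈ 0#

count : {m : ℕ} {P : Fin m → Set} → (∀ v → Dec (P v)) → ℕ
count {m} P? = length (filter P? (allFin m))

sumFin : (n : ℕ) → (Fin n → ℕ) → ℕ
sumFin n f = sum (map f (allFin n))

record Graph (m : ℕ) : Set where
  field
    e      : ℕ
    ends   : Fin e → Fin m × Fin m
    noLoop : ∀ a → ¬ (proj₁ (ends a) ≡ proj₂ (ends a))
    simple : ∀ a b → (ends a ≡ ends b ⊎ ends a ≡ (proj₂ (ends b) , proj₁ (ends b))) → a ≡ b

Incident : {m : ℕ} (G : Graph m) → Fin (Graph.e G) → Fin m → Set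
Incident G a v = proj₁ (Graph.ends G a) ≡ v ⊎ proj₂ (Graph.ends G a) ≡ v

InVE : {m n : ℕ} (G : Graph m) (assign : Fin (Graph.e G) → Fin n) → Fin n → Fin m → Set
InVE G assign i v = ∃ λ a → assign a ≡ i × Incident G a v

InVE? : {m n : ℕ} (G : Graph m) (assign : Fin (Graph.e G) → Fin n) (i : Fin n) (v : Fin m)
      → Dec (InVE G assign i v)
InVE? G assign i v = any? λ a → (assign a ≟ i) ×-dec
  ((proj₁ (Graph.ends G a) ≟ v) ⊎-dec (proj₂ (Graph.ends G a) ≟ v))

sizeVE : {m n : ℕ} (G : Graph m) (assign : Fin (Graph.e G) → Fin n) → Fin n → ℕ
sizeVE G assign i = count (InVE? G assign i)

-- Double counting: Σᵢ |V(Eᵢ)| counts the pairs (i, v) such that v is incident to an edge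
-- assigned to the point i.  Every such i lies on the line ψ(v), so each vertex is counted
-- at most |ψ(v)| times, and a line has at most q + 1 points: on the line u · v = 0 with
-- uₐ ≠ 0 the coordinate vₐ is determined by (v_b, v_c), so a point [v] of the line is
-- determined by its slope v_b / v_c ∈ F_q ∪ {∞}.
module Submission where

open import Defs
open import Data.Nat as ℕ using (ℕ; zero; suc; _≤_; z≤n)
open import Data.Nat.Properties using (+-mono-≤; +-0-commutativeMonoid; ≤-trans; ≤-reflexive; m≤m+n; module ≤-Reasoning)
open import Data.Nat.Solver using (module +-*-Solver)
open import Data.Nat.ListAction using (sum)
open import Data.Nat.Primality using (Prime)
open import Data.Fin using (Fin; zero; suc; fromℕ; inject₁)
open import Data.Fin.Properties as Fin using (injective⇒≤; fromℕ≢inject₁; inject₁-injective)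
open import Data.List using (List; []; _∷_; length; filter; map; lookup; tabulate; allFin)
open import Data.List.Properties using (map-tabulate)
open import Data.List.Membership.Propositional.Properties using (∈-lookup; ∈-filter⁻)
open import Data.List.Relation.Unary.All as All using ()
open import Data.List.Relation.Unary.AllPairs using (_∷_)
open import Data.List.Relation.Unary.Unique.Propositional using (Unique)
import Data.List.Relation.Unary.Unique.Propositional.Properties as Unique
open import Data.List.Relation.Binary.Sublist.Propositional using (⊆-refl)
open import Data.List.Relation.Binary.Sublist.Propositional.Properties using (filter⁺; length-mono-≤)
open import Data.Product using (_×_; _,_; proj₁; proj₂)
open import Data.Sum using (inj₁; inj₂)
open import Data.Empty using (⊥-elim)
open import Function using (_∘_; id)
open import Function.Definitions using (Injective)
open import Function.Bundles using (Bijection)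
open import Relation.Nullary using (¬_; Dec; yes; no)
open import Relation.Binary.PropositionalEquality as ≡ using (_≡_; cong; module ≡-Reasoning)
open import Algebra.Properties.CommutativeMonoid.Sum +-0-commutativeMonoid
  using (sum-syntax; ∑-comm; sum-cong-≗)

indicator : {P : Set} → Dec P → ℕ
indicator (yes _) = 1
indicator (no _)  = 0

length-filter≡sum-indicator : ∀ {A : Set} {P : A → Set} (P? : ∀ x → Dec (P x)) (xs : List A) →
  length (filter P? xs) ≡ sum (map (indicator ∘ P?) xs)
length-filter≡sum-indicator P? [] = ≡.refl
length-filter≡sum-indicator P? (x ∷ xs) with P? x
... | yes _ = cong suc (length-filter≡sum-indicator P? xs)
... | no _  = length-filter≡sum-indicator P? xs

sum-tabulate : ∀ {n} (f : Fin n → ℕ) → sum (tabulate f) ≡ ∑[ i < n ] f i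
sum-tabulate {zero}  f = ≡.refl
sum-tabulate {suc n} f = cong (f zero ℕ.+_) (sum-tabulate (f ∘ suc))

sumFin≡∑ : ∀ n (f : Fin n → ℕ) → sumFin n f ≡ ∑[ i < n ] f i
sumFin≡∑ n f = ≡.trans (cong sum (map-tabulate id f)) (sum-tabulate f)

count≡∑-indicator : ∀ {m} {P : Fin m → Set} (P? : ∀ i → Dec (P i)) →
  count P? ≡ ∑[ i < m ] indicator (P? i)
count≡∑-indicator {m} P? = ≡.trans (length-filter≡sum-indicator P? (allFin m)) (sumFin≡∑ m (indicator ∘ P?))

count-mono : ∀ {m} {P Q : Fin m → Set} (P? : ∀ i → Dec (P i)) (Q? : ∀ i → Dec (Q i)) →
  (∀ i → P i → Q i) → count P? ≤ count Q?
count-mono {m} P? Q? P⇒Q = length-mono-≤ (filter⁺ P? Q? (λ { ≡.refl → P⇒Q _ }) (⊆-refl {x = allFin m}))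

lookup-injective : ∀ {A : Set} {xs : List A} → Unique xs → Injective _≡_ _≡_ (lookup xs)
lookup-injective {xs = _ ∷ _} (_ ∷ _)    {zero}  {zero}  _ = ≡.refl
lookup-injective {xs = _ ∷ _} (x∉ ∷ _)   {zero}  {suc j} e = ⊥-elim (All.lookup x∉ (∈-lookup j) e)
lookup-injective {xs = _ ∷ _} (x∉ ∷ _)   {suc i} {zero}  e = ⊥-elim (All.lookup x∉ (∈-lookup i) (≡.sym e))
lookup-injective {xs = _ ∷ _} (_ ∷ uxs)  {suc i} {suc j} e = cong suc (lookup-injective uxs e)

count≤-injectiveOn : ∀ {m r} {P : Fin m → Set} (P? : ∀ i → Dec (P i)) (f : Fin m → Fin r) →
  (∀ {i j} → P i → P j → f i ≡ f j → i ≡ j) → count P? ≤ r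
count≤-injectiveOn {m} {P = P} P? f f-inj = injective⇒≤ (lookup-injective unique ∘ f-inj (holds _) (holds _))
  where
  candidates = filter P? (allFin m)

  unique : Unique candidates
  unique = Unique.filter⁺ P? (Unique.allFin⁺ m)

  holds : ∀ k → P (lookup candidates k)
  holds k = proj₂ (∈-filter⁻ P? {xs = allFin m} (∈-lookup k))

∑-count-comm : ∀ {m n} {R : Fin n → Fin m → Set} (R? : ∀ i v → Dec (R i v)) →
  ∑[ i < n ] count (R? i) ≡ ∑[ v < m ] count (λ i → R? i v)
∑-count-comm {m} {n} R? = begin
  ∑[ i < n ] count (R? i)                       ≡⟨ sum-cong-≗ (count≡∑-indicator ∘ R?) ⟩
  ∑[ i < n ] ∑[ v < m ] indicator (R? i v)      ≡⟨ ∑-comm (λ i v → indicator (R? i v)) ⟩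
  ∑[ v < m ] ∑[ i < n ] indicator (R? i v)      ≡⟨ sum-cong-≗ (λ v → ≡.sym (count≡∑-indicator (λ i → R? i v))) ⟩
  ∑[ v < m ] count (λ i → R? i v)               ∎
  where open ≡-Reasoning

∑≤* : ∀ {n} (f : Fin n → ℕ) {c} → (∀ i → f i ≤ c) → ∑[ i < n ] f i ≤ n ℕ.* c
∑≤* {zero}  f f≤c = z≤n
∑≤* {suc n} f f≤c = +-mono-≤ (f≤c zero) (∑≤* (f ∘ suc) (f≤c ∘ suc))

module FiniteFieldProperties {q : ℕ} (F : FiniteField q) where
  open FiniteField F hiding (zero)
  open Bijection counting using (to; injective) renaming (cong to to-cong)
  open import Relation.Binary.Reasoning.Setoid setoid
  open import Algebra.Solver.Ring.NaturalCoefficients.Default commutativeSemiring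
    using (solve; _:=_; _:+_; _:*_)
  open import Algebra.Properties.Group +-group using (∙-cancelʳ)

  _≈?_ : ∀ x y → Dec (x ≈ y)
  x ≈? y with to x Fin.≟ to y
  ... | yes tx≡ty = yes (injective tx≡ty)
  ... | no tx≢ty  = no (tx≢ty ∘ to-cong)

  _⁻¹⟨_⟩ : ∀ x → ¬ (x ≈ 0#) → Carrier
  x ⁻¹⟨ x≉0 ⟩ = proj₁ (proj₂ isField x x≉0)

  *-inverseʳ : ∀ x (x≉0 : ¬ (x ≈ 0#)) → x * x ⁻¹⟨ x≉0 ⟩ ≈ 1#
  *-inverseʳ x x≉0 = proj₂ (proj₂ isField x x≉0)

  ⁻¹-*-cancelˡ : ∀ a (a≉0 : ¬ (a ≈ 0#)) x → a ⁻¹⟨ a≉0 ⟩ * (a * x) ≈ x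
  ⁻¹-*-cancelˡ a a≉0 x = begin
    a⁻¹ * (a * x)    ≈⟨ solve 3 (λ a a⁻¹ x → a⁻¹ :* (a :* x) := (a :* a⁻¹) :* x) refl a a⁻¹ x ⟩
    (a * a⁻¹) * x    ≈⟨ *-congʳ (*-inverseʳ a a≉0) ⟩
    1# * x           ≈⟨ *-identityˡ x ⟩
    x                ∎
    where a⁻¹ = a ⁻¹⟨ a≉0 ⟩

  *-cancelˡ : ∀ a {x y} → ¬ (a ≈ 0#) → a * x ≈ a * y → x ≈ y
  *-cancelˡ a {x} {y} a≉0 ax≈ay = begin
    x                    ≈⟨ ⁻¹-*-cancelˡ a a≉0 x ⟨
    a ⁻¹⟨ a≉0 ⟩ * (a * x) ≈⟨ *-congˡ ax≈ay ⟩
    a ⁻¹⟨ a≉0 ⟩ * (a * y) ≈⟨ ⁻¹-*-cancelˡ a a≉0 y ⟩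
    y                    ∎

  x≈x*y⁻¹*y : ∀ x y (y≉0 : ¬ (y ≈ 0#)) → x ≈ (x * y ⁻¹⟨ y≉0 ⟩) * y
  x≈x*y⁻¹*y x y y≉0 = begin
    x                      ≈⟨ *-identityʳ x ⟨
    x * 1#                 ≈⟨ *-congˡ (*-inverseʳ y y≉0) ⟨
    x * (y * y ⁻¹⟨ y≉0 ⟩)  ≈⟨ solve 3 (λ x y y⁻¹ → x :* (y :* y⁻¹) := (x :* y⁻¹) :* y) refl x y (y ⁻¹⟨ y≉0 ⟩) ⟩
    (x * y ⁻¹⟨ y≉0 ⟩) * y  ∎

  module Slope (a b c : Fin 3)
    (dot-expand : ∀ x y → dot F x y ≈ (x a * y a + x b * y b) + x c * y c)
    (coordinate-elim : ∀ {Pr : Fin 3 → Set} → Pr a → Pr b → Pr c → ∀ d → Pr d)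
    (u : Vec3 F) (ua≉0 : ¬ (u a ≈ 0#)) where

    Orthogonal : Vec3 F → Set
    Orthogonal v = dot F u v ≈ 0#

    -- Subtracting l (u · w) = 0 from u · v = 0 leaves u_a (v_a − l w_a) = 0.
    orthogonal-coordinate : ∀ {v w} l → Orthogonal v → Orthogonal w →
      v b ≈ l * w b → v c ≈ l * w c → v a ≈ l * w a
    orthogonal-coordinate {v} {w} l u⊥v u⊥w vb≈ vc≈ = *-cancelˡ (u a) ua≉0 (∙-cancelʳ rest _ _ (begin
      u a * v a + rest                              ≈⟨ solve 7 (λ ua va ub wb uc wc l →
                                                        ua :* va :+ l :* (ub :* wb :+ uc :* wc)
                                                        := (ua :* va :+ ub :* (l :* wb)) :+ uc :* (l :* wc))
                                                        refl (u a) (v a) (u b) (w b) (u c) (w c) l ⟩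
      (u a * v a + u b * (l * w b)) + u c * (l * w c) ≈⟨ +-cong (+-congˡ (*-congˡ vb≈)) (*-congˡ vc≈) ⟨
      (u a * v a + u b * v b) + u c * v c           ≈⟨ trans (sym (dot-expand u v)) u⊥v ⟩
      0#                                            ≈⟨ zeroʳ l ⟨
      l * 0#                                        ≈⟨ *-congˡ (trans (sym (dot-expand u w)) u⊥w) ⟨
      l * ((u a * w a + u b * w b) + u c * w c)     ≈⟨ solve 7 (λ l ua wa ub wb uc wc →
                                                        l :* ((ua :* wa :+ ub :* wb) :+ uc :* wc)
                                                        := ua :* (l :* wa) :+ l :* (ub :* wb :+ uc :* wc))
                                                        refl l (u a) (w a) (u b) (w b) (u c) (w c) ⟩
      u a * (l * w a) + rest                        ∎))
      where rest = l * (u b * w b + u c * w c)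

    proportional : ∀ {v w} l → Orthogonal v → Orthogonal w →
      v b ≈ l * w b → v c ≈ l * w c → _≈Mult_ F v w
    proportional {v} {w} l u⊥v u⊥w vb≈ vc≈ =
      l , coordinate-elim {λ d → v d ≈ l * w d} (orthogonal-coordinate l u⊥v u⊥w vb≈ vc≈) vb≈ vc≈

    nonzero-at-infinity : ∀ {v} → ¬ IsZeroVec F v → Orthogonal v → v c ≈ 0# → ¬ (v b ≈ 0#)
    nonzero-at-infinity {v} v≉0 u⊥v vc≈0 vb≈0 = v≉0 (coordinate-elim {λ d → v d ≈ 0#} va≈0 vb≈0 vc≈0)
      where
      zero≈ : ∀ {x} → x ≈ 0# → x ≈ 0# * x
      zero≈ {x} x≈0 = trans x≈0 (sym (zeroˡ x))

      va≈0 : v a ≈ 0#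
      va≈0 = trans (orthogonal-coordinate 0# u⊥v u⊥v (zero≈ vb≈0) (zero≈ vc≈0)) (zeroˡ (v a))

    -- Fin (suc q) is F_q ∪ {∞}, with fromℕ q as ∞.
    slope : Vec3 F → Fin (suc q)
    slope v with v c ≈? 0#
    ... | yes _    = fromℕ q
    ... | no vc≉0  = inject₁ (to (v b * v c ⁻¹⟨ vc≉0 ⟩))

    slope-injective : ∀ {v w} → ¬ IsZeroVec F v → ¬ IsZeroVec F w → Orthogonal v → Orthogonal w →
      slope v ≡ slope w → _≈Mult_ F v w
    slope-injective {v} {w} v≉0 w≉0 u⊥v u⊥w same with v c ≈? 0# | w c ≈? 0#
    ... | yes _    | no _     = ⊥-elim (fromℕ≢inject₁ same)
    ... | no _     | yes _    = ⊥-elim (fromℕ≢inject₁ (≡.sym same))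
    ... | yes vc≈0 | yes wc≈0 = proportional l u⊥v u⊥w (x≈x*y⁻¹*y (v b) (w b) wb≉0)
      (trans vc≈0 (trans (sym (zeroʳ l)) (*-congˡ (sym wc≈0))))
      where
      wb≉0 = nonzero-at-infinity w≉0 u⊥w wc≈0
      l = v b * w b ⁻¹⟨ wb≉0 ⟩
    ... | no vc≉0  | no wc≉0  = proportional l u⊥v u⊥w vb≈ (x≈x*y⁻¹*y (v c) (w c) wc≉0)
      where
      l = v c * w c ⁻¹⟨ wc≉0 ⟩
      same-ratio : v b * v c ⁻¹⟨ vc≉0 ⟩ ≈ w b * w c ⁻¹⟨ wc≉0 ⟩
      same-ratio = injective (inject₁-injective same)
      vb≈ : v b ≈ l * w b
      vb≈ = begin
        v b                          ≈⟨ x≈x*y⁻¹*y (v b) (v c) vc≉0 ⟩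
        (v b * v c ⁻¹⟨ vc≉0 ⟩) * v c ≈⟨ *-congʳ same-ratio ⟩
        (w b * w c ⁻¹⟨ wc≉0 ⟩) * v c ≈⟨ solve 3 (λ x y z → (x :* y) :* z := (z :* y) :* x) refl (w b) (w c ⁻¹⟨ wc≉0 ⟩) (v c) ⟩
        l * w b                      ∎

  module _ {n : ℕ} (P : PointIndexing F n) where
    open PointIndexing P

    OnLine? : ∀ j i → Dec (OnLine F P j i)
    OnLine? j i = _ ≈? _

    line-size≤-in-frame : ∀ j (a b c : Fin 3)
      (dot-expand : ∀ x y → dot F x y ≈ (x a * y a + x b * y b) + x c * y c)
      (coordinate-elim : ∀ {Pr : Fin 3 → Set} → Pr a → Pr b → Pr c → ∀ d → Pr d) →
      ¬ (rep j a ≈ 0#) → count (OnLine? j) ≤ suc q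
    line-size≤-in-frame j a b c dot-expand coordinate-elim ua≉0 =
      count≤-injectiveOn (OnLine? j) (slope ∘ rep) λ {i} {i'} i∈j i'∈j same →
        rep-unique (rep i) i i' (rep-nonzero i) (1# , λ _ → sym (*-identityˡ _))
          (slope-injective (rep-nonzero i) (rep-nonzero i') i∈j i'∈j same)
      where
      open Slope a b c dot-expand coordinate-elim (rep j) ua≉0

    coordinate-elim₀₁₂ : ∀ {Pr : Fin 3 → Set} → Pr zero → Pr (suc zero) → Pr (suc (suc zero)) → ∀ d → Pr d
    coordinate-elim₀₁₂ p₀ p₁ p₂ zero             = p₀
    coordinate-elim₀₁₂ p₀ p₁ p₂ (suc zero)       = p₁
    coordinate-elim₀₁₂ p₀ p₁ p₂ (suc (suc zero)) = p₂

    line-size≤ : ∀ j → count (OnLine? j) ≤ suc q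
    line-size≤ j with rep j zero ≈? 0# | rep j (suc zero) ≈? 0# | rep j (suc (suc zero)) ≈? 0#
    ... | no u₀≉0 | _ | _ =
      line-size≤-in-frame j zero (suc zero) (suc (suc zero))
        (λ _ _ → refl) coordinate-elim₀₁₂ u₀≉0
    ... | yes _ | no u₁≉0 | _ =
      line-size≤-in-frame j (suc zero) zero (suc (suc zero))
        (λ _ _ → +-congʳ (+-comm _ _)) (λ p₁ p₀ p₂ → coordinate-elim₀₁₂ p₀ p₁ p₂) u₁≉0
    ... | yes _ | yes _ | no u₂≉0 =
      line-size≤-in-frame j (suc (suc zero)) zero (suc zero)
        (λ _ _ → solve 3 (λ x y z → (x :+ y) :+ z := (z :+ x) :+ y) refl _ _ _)
        (λ p₂ p₀ p₁ → coordinate-elim₀₁₂ p₀ p₁ p₂) u₂≉0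
    ... | yes u₀≈0 | yes u₁≈0 | yes u₂≈0 =
      ⊥-elim (rep-nonzero j (coordinate-elim₀₁₂ {λ d → rep j d ≈ 0#} u₀≈0 u₁≈0 u₂≈0))

open import Data.Nat using (_+_; _*_; _^_)
open FiniteFieldProperties using (OnLine?; line-size≤)

module _ {q : ℕ} (F : FiniteField q) {n : ℕ} (P : PointIndexing F n)
  {m : ℕ} (G : Graph m) (ψ : Fin m → Fin n) (assign : Fin (Graph.e G) → Fin n)
  (assign-onLines : ∀ a → OnLine F P (ψ (proj₁ (Graph.ends G a))) (assign a)
                        × OnLine F P (ψ (proj₂ (Graph.ends G a))) (assign a)) where

  InVE⇒OnLine : ∀ v i → InVE G assign i v → OnLine F P (ψ v) i
  InVE⇒OnLine v i (a , ≡.refl , inj₁ ≡.refl) = proj₁ (assign-onLines a)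
  InVE⇒OnLine v i (a , ≡.refl , inj₂ ≡.refl) = proj₂ (assign-onLines a)

  sum-sizeVE≤ : sumFin n (sizeVE G assign) ≤ m * suc q
  sum-sizeVE≤ = begin
    sumFin n (sizeVE G assign)                     ≡⟨ sumFin≡∑ n (sizeVE G assign) ⟩
    ∑[ i < n ] count (InVE? G assign i)            ≡⟨ ∑-count-comm (InVE? G assign) ⟩
    ∑[ v < m ] count (λ i → InVE? G assign i v)    ≤⟨ ∑≤* _ vertex-multiplicity≤ ⟩
    m * suc q                                      ∎
    where
    open ≤-Reasoning
    vertex-multiplicity≤ : ∀ v → count (λ i → InVE? G assign i v) ≤ suc q
    vertex-multiplicity≤ v = ≤-trans
      (count-mono (λ i → InVE? G assign i v) (OnLine? F P (ψ v)) (InVE⇒OnLine v))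
      (line-size≤ F P (ψ v))

theorem4 : (p k : ℕ) → Prime p → 1 ≤ k →
    (F : FiniteField (p ^ k)) →
    (P : PointIndexing F (p ^ k * p ^ k + p ^ k + 1)) →
    (m : ℕ) → 1 ≤ m → (G : Graph m) →
    (ψ : Fin m → Fin (p ^ k * p ^ k + p ^ k + 1)) →
    (assign : Fin (Graph.e G) → Fin (p ^ k * p ^ k + p ^ k + 1)) →
    (∀ a → OnLine F P (ψ (proj₁ (Graph.ends G a))) (assign a)
         × OnLine F P (ψ (proj₂ (Graph.ends G a))) (assign a)) →
    (sumFin (p ^ k * p ^ k + p ^ k + 1) (sizeVE G assign) ≤ (p ^ k + 1) * m)
      × (p ^ k * p ^ k + p ^ k + 1 ≤ (p ^ k + 1) * (p ^ k + 1))
      × (p ^ k * p ^ k ≤ p ^ k * p ^ k + p ^ k + 1)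
theorem4 p k _ _ F P m _ G ψ assign assign-onLines =
  ≤-trans (sum-sizeVE≤ F P G ψ assign assign-onLines)
          (≤-reflexive (solve 2 (λ m q → m :* (con 1 :+ q) := (q :+ con 1) :* m) ≡.refl m q))
  , ≤-trans (m≤m+n (q * q + q + 1) q)
            (≤-reflexive (solve 1 (λ q → q :* q :+ q :+ con 1 :+ q := (q :+ con 1) :* (q :+ con 1)) ≡.refl q))
  , ≤-trans (m≤m+n (q * q) q) (m≤m+n (q * q + q) 1)
  where
  q = p ^ k
  open +-*-Solver
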